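{- Let $B\ge 2$ and let $g\in\mathbb{Z}[i]$ satisfy $\max\{|\mathrm{Re}(g)|,|\mathrm{Im}(g)|\}\ge B^3$ if $B\ge 7$, and $\max\{|\mathrm{Re}(g)|,|\mathrm{Im}(g)|\}\ge B^4$ if $2\le B\le 6$. Then $|S_B(g)|<|g|$.
   Context: Fix an integer $B\ge 2$. Every nonzero Gaussian integer $a+bi$ is written uniquely as $a+bi=\sum_{j=0}^n (a_j+b_ji)B^j$ with $a_j,b_j\in\mathbb{Z}$, $a_n,b_n$ not both $0$, and for each $j$: $|a_j|\le B-1$, $|b_j|\le B-1$, $\operatorname{sgn}(a)a_j\ge 0$, $\operatorname{sgn}(b)b_j\ge 0$. The Gaussian $B$-happy function $S_B:\mathbb{Z}[i]\to\mathbb{Z}[i]$ is defined by $S_B(0)=0$ and $S_B(a+bi)=\sum_{j=0}^n (a_j+b_ji)^2$. Here $|\cdot|$ is the complex absolute value. -}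

module Defs where

open import Data.Nat as ℕ using (ℕ; zero; suc; NonZero)
open import Data.Nat.DivMod using (_/_; _%_)
open import Data.Integer as ℤ using (ℤ; +_; ∣_∣; sign)
open import Data.Sign as Sign using (Sign)
open import Data.List using (List; []; _∷_)
open import Data.Product using (_×_; _,_; proj₁; proj₂)

ℤ[i] : Set
ℤ[i] = ℤ × ℤ

re im : ℤ[i] → ℤ
re = proj₁
im = proj₂

_+ᵍ_ : ℤ[i] → ℤ[i] → ℤ[i]
(a , b) +ᵍ (c , d) = (a ℤ.+ c , b ℤ.+ d)

_*ᵍ_ : ℤ[i] → ℤ[i] → ℤ[i]
(a , b) *ᵍ (c , d) = (a ℤ.* c ℤ.- b ℤ.* d , a ℤ.* d ℤ.+ b ℤ.* c)

normSq : ℤ[i] → ℤ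
normSq (a , b) = a ℤ.* a ℤ.+ b ℤ.* b

-- base-B digits of n (least significant first), using fuel ≥ number of digits
digitsFuel : (B : ℕ) → .{{NonZero B}} → ℕ → ℕ → List ℕ
digitsFuel B zero    n = []
digitsFuel B (suc f) zero = []
digitsFuel B (suc f) n@(suc _) = (n % B) ∷ digitsFuel B f (n / B)

-- base-B digits of n ≥ 0 (for B ≥ 2, n is an adequate amount of fuel)
digits : (B : ℕ) → .{{NonZero B}} → ℕ → List ℕ
digits B n = digitsFuel B n n

-- signed digits of an integer x: the digits of |x| multiplied by sgn(x);
-- these are exactly the a_j with |a_j| ≤ B-1 and sgn(x) a_j ≥ 0
signedDigits : (B : ℕ) → .{{NonZero B}} → ℤ → List ℤ
signedDigits B x = go (digits B ∣ x ∣)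
  where
  go : List ℕ → List ℤ
  go [] = []
  go (d ∷ ds) = (sign x ℤ.◃ d) ∷ go ds

zipPad : List ℤ → List ℤ → List ℤ[i]
zipPad [] [] = []
zipPad [] (b ∷ bs) = (+ 0 , b) ∷ zipPad [] bs
zipPad (a ∷ as) [] = (a , + 0) ∷ zipPad as []
zipPad (a ∷ as) (b ∷ bs) = (a , b) ∷ zipPad as bs

gdigits : (B : ℕ) → .{{NonZero B}} → ℤ[i] → List ℤ[i]
gdigits B (a , b) = zipPad (signedDigits B a) (signedDigits B b)

sumSq : List ℤ[i] → ℤ[i]
sumSq [] = (+ 0 , + 0)
sumSq (z ∷ zs) = (z *ᵍ z) +ᵍ sumSq zs

-- the Gaussian B-happy function S_B (S_B(0) = 0 since 0 has no digits)
S : (B : ℕ) → .{{NonZero B}} → ℤ[i] → ℤ[i]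
S B g = sumSq (gdigits B g)

{-# OPTIONS --safe #-}
-- Each Gaussian digit of g has coordinates of size at most c = B - 1, so its square has real part at
-- most c² and imaginary part at most 2c² in absolute value; with L digits this gives
-- |S_B(g)|² ≤ 5 (L c²)², while B^(L-1) ≤ max(|Re g|, |Im g|) ≤ |g|. As L grows the bound 5 (L c²)²
-- at most quadruples per step while B^(2L) grows by B² ≥ 4, so once 5 (L₀ c²)² < B^(2(L₀-1)) holds
-- (checked at L₀ = 4 for B ≥ 7 and at L₀ = 5 for B ≤ 6) the estimate wins for every L ≥ L₀; for
-- L ≤ L₀ the hypothesis max(|Re g|, |Im g|) ≥ B^(L₀-1) suffices.
module Submission where

open import Defs
open import Data.Nat as ℕ using (ℕ; _≤_; _^_; _⊔_)
open import Data.Nat.Properties as ℕₚ using (<-≤-trans)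
open import Data.Integer as ℤ using (∣_∣; _<_)
open import Data.Product using (_×_)

open import Data.Integer using (ℤ; +_; -[1+_]; sign; _◃_)
import Data.Integer.Properties as ℤₚ
open import Data.List using (List; []; _∷_; length; map)
open import Data.List.Properties using (length-map)
open import Data.List.Relation.Unary.All as All using (All; []; _∷_)
open import Data.List.Relation.Unary.All.Properties using (map⁺)
open import Data.Nat using (zero; suc; _+_; _*_; _∸_; z≤n; s≤s; s≤s⁻¹; NonZero; >-nonZero⁻¹)
open import Data.Nat.DivMod using (_/_; m%n<n; m/n*n≤m)
open import Data.Nat.Solver using (module +-*-Solver)
open import Data.Product using (_,_)
open import Relation.Binary.PropositionalEquality
open import Relation.Nullary using (yes; no)
open +-*-Solver using (solve; _:+_; _:*_; _:^_; _:=_; con)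

module _ (B : ℕ) .{{_ : NonZero B}} where

  digitsFuel-zero : ∀ f → digitsFuel B f 0 ≡ []
  digitsFuel-zero zero    = refl
  digitsFuel-zero (suc f) = refl

  All-<-digitsFuel : ∀ f n → All (ℕ._< B) (digitsFuel B f n)
  All-<-digitsFuel zero    n       = []
  All-<-digitsFuel (suc f) zero    = []
  All-<-digitsFuel (suc f) (suc n) = m%n<n (suc n) B ∷ All-<-digitsFuel f (suc n / B)

  ^length-digitsFuel≤ : ∀ f n → 1 ≤ n → B ^ length (digitsFuel B f n) ≤ B * n
  ^length-digitsFuel≤ zero    n       1≤n = ℕₚ.*-mono-≤ (>-nonZero⁻¹ B) 1≤n
  ^length-digitsFuel≤ (suc f) (suc n) _ with suc n / B in eq
  ... | zero  rewrite digitsFuel-zero f = ℕₚ.*-monoʳ-≤ B (s≤s z≤n)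
  ... | suc q = ℕₚ.*-monoʳ-≤ B (ℕₚ.≤-trans (^length-digitsFuel≤ f (suc q) (s≤s z≤n)) B*q≤n)
    where
    open ℕₚ.≤-Reasoning
    B*q≤n : B * suc q ≤ suc n
    B*q≤n = begin
      B * suc q       ≡⟨ ℕₚ.*-comm B (suc q) ⟩
      suc q * B       ≡⟨ cong (_* B) eq ⟨
      suc n / B * B   ≤⟨ m/n*n≤m (suc n) B ⟩
      suc n           ∎

  ^length-digits≤ : ∀ {k m} → 1 ≤ m → k ≤ m → B ^ length (digits B k) ≤ B * m
  ^length-digits≤ {zero}  1≤m _   = ℕₚ.*-mono-≤ (>-nonZero⁻¹ B) 1≤m
  ^length-digits≤ {suc k} _   k≤m =
    ℕₚ.≤-trans (^length-digitsFuel≤ (suc k) (suc k) (s≤s z≤n)) (ℕₚ.*-monoʳ-≤ B k≤m)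

  module _ (x : ℤ) where

    private
      -- signedDigits maps over the digits with a local helper that cannot be referred to by
      -- name; the meta signDigits is solved to that helper by unification.
      mutual
        signDigits : List ℕ → List ℤ
        signDigits = _

        signedDigits≡signDigits : signedDigits B x ≡ signDigits (digits B ∣ x ∣)
        signedDigits≡signDigits with digits B ∣ x ∣
        ... | _ = refl

      signDigits≡map : ∀ ds → signDigits ds ≡ map (sign x ◃_) ds
      signDigits≡map []       = refl
      signDigits≡map (d ∷ ds) = cong ((sign x ◃ d) ∷_) (signDigits≡map ds)

    signedDigits≡map : signedDigits B x ≡ map (sign x ◃_) (digits B ∣ x ∣)
    signedDigits≡map = trans signedDigits≡signDigits (signDigits≡map (digits B ∣ x ∣))

    All-∣∣<-signedDigits : All (λ z → ∣ z ∣ ℕ.< B) (signedDigits B x)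
    All-∣∣<-signedDigits rewrite signedDigits≡map =
      map⁺ (All.map (subst (ℕ._< B) (sym (ℤₚ.abs-◃ (sign x) _))) (All-<-digitsFuel ∣ x ∣ ∣ x ∣))

    length-signedDigits : length (signedDigits B x) ≡ length (digits B ∣ x ∣)
    length-signedDigits rewrite signedDigits≡map = length-map (sign x ◃_) (digits B ∣ x ∣)

All-zipPad : ∀ {p} (P : ℤ → Set p) → P (+ 0) → ∀ {xs ys} → All P xs → All P ys →
             All (λ z → P (re z) × P (im z)) (zipPad xs ys)
All-zipPad P P0 {[]}     {[]}     []       []       = []
All-zipPad P P0 {[]}     {y ∷ ys} []       (q ∷ qs) = (P0 , q) ∷ All-zipPad P P0 [] qs
All-zipPad P P0 {x ∷ xs} {[]}     (p ∷ ps) []       = (p , P0) ∷ All-zipPad P P0 ps []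
All-zipPad P P0 {x ∷ xs} {y ∷ ys} (p ∷ ps) (q ∷ qs) = (p , q) ∷ All-zipPad P P0 ps qs

length-zipPad : ∀ xs ys → length (zipPad xs ys) ≡ length xs ⊔ length ys
length-zipPad []       []       = refl
length-zipPad []       (y ∷ ys) = cong suc (length-zipPad [] ys)
length-zipPad (x ∷ xs) []       = cong suc (trans (length-zipPad xs []) (ℕₚ.⊔-identityʳ (length xs)))
length-zipPad (x ∷ xs) (y ∷ ys) = cong suc (length-zipPad xs ys)

i*i≡∣i∣*∣i∣ : ∀ i → i ℤ.* i ≡ + (∣ i ∣ * ∣ i ∣)
i*i≡∣i∣*∣i∣ (+ n)    = ℤₚ.+◃n≡+n (n * n)
i*i≡∣i∣*∣i∣ -[1+ n ] = ℤₚ.+◃n≡+n _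

normSq≡ : ∀ z → normSq z ≡ + (∣ re z ∣ * ∣ re z ∣ + ∣ im z ∣ * ∣ im z ∣)
normSq≡ (a , b) = begin
  a ℤ.* a ℤ.+ b ℤ.* b                    ≡⟨ cong₂ ℤ._+_ (i*i≡∣i∣*∣i∣ a) (i*i≡∣i∣*∣i∣ b) ⟩
  + (∣ a ∣ * ∣ a ∣) ℤ.+ + (∣ b ∣ * ∣ b ∣)  ≡⟨ ℤₚ.pos-+ (∣ a ∣ * ∣ a ∣) (∣ b ∣ * ∣ b ∣) ⟨
  + (∣ a ∣ * ∣ a ∣ + ∣ b ∣ * ∣ b ∣)        ∎
  where open ≡-Reasoning

Bounded : ℕ → ℤ[i] → Set
Bounded c z = ∣ re z ∣ ≤ c × ∣ im z ∣ ≤ c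

module _ {c : ℕ} where

  ∣re[z²]∣≤ : ∀ {z} → Bounded c z → ∣ re (z *ᵍ z) ∣ ≤ c * c
  ∣re[z²]∣≤ {p , q} (p≤c , q≤c) = begin
    ∣ p ℤ.* p ℤ.- q ℤ.* q ∣                        ≡⟨ cong ∣_∣ (cong₂ ℤ._-_ (i*i≡∣i∣*∣i∣ p) (i*i≡∣i∣*∣i∣ q)) ⟩
    ∣ + (∣ p ∣ * ∣ p ∣) ℤ.- + (∣ q ∣ * ∣ q ∣) ∣    ≡⟨ cong ∣_∣ (ℤₚ.m-n≡m⊖n (∣ p ∣ * ∣ p ∣) (∣ q ∣ * ∣ q ∣)) ⟩
    ∣ (∣ p ∣ * ∣ p ∣) ℤ.⊖ (∣ q ∣ * ∣ q ∣) ∣        ≤⟨ ℤₚ.∣m⊝n∣≤m⊔n (∣ p ∣ * ∣ p ∣) (∣ q ∣ * ∣ q ∣) ⟩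
    (∣ p ∣ * ∣ p ∣) ⊔ (∣ q ∣ * ∣ q ∣)              ≤⟨ ℕₚ.⊔-lub (ℕₚ.*-mono-≤ p≤c p≤c) (ℕₚ.*-mono-≤ q≤c q≤c) ⟩
    c * c                                          ∎
    where open ℕₚ.≤-Reasoning

  ∣im[z²]∣≤ : ∀ {z} → Bounded c z → ∣ im (z *ᵍ z) ∣ ≤ 2 * (c * c)
  ∣im[z²]∣≤ {p , q} (p≤c , q≤c) = begin
    ∣ p ℤ.* q ℤ.+ q ℤ.* p ∣            ≤⟨ ℤₚ.∣i+j∣≤∣i∣+∣j∣ (p ℤ.* q) (q ℤ.* p) ⟩
    ∣ p ℤ.* q ∣ + ∣ q ℤ.* p ∣          ≡⟨ cong₂ _+_ (ℤₚ.∣i*j∣≡∣i∣*∣j∣ p q) (ℤₚ.∣i*j∣≡∣i∣*∣j∣ q p) ⟩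
    ∣ p ∣ * ∣ q ∣ + ∣ q ∣ * ∣ p ∣      ≤⟨ ℕₚ.+-mono-≤ (ℕₚ.*-mono-≤ p≤c q≤c) (ℕₚ.*-mono-≤ q≤c p≤c) ⟩
    c * c + c * c                      ≡⟨ cong (λ t → c * c + t) (ℕₚ.+-identityʳ (c * c)) ⟨
    2 * (c * c)                        ∎
    where open ℕₚ.≤-Reasoning

  ∣re-sumSq∣≤ : ∀ {zs} → All (Bounded c) zs → ∣ re (sumSq zs) ∣ ≤ length zs * (c * c)
  ∣re-sumSq∣≤ []                  = z≤n
  ∣re-sumSq∣≤ {z ∷ zs} (bz ∷ bzs) =
    ℕₚ.≤-trans (ℤₚ.∣i+j∣≤∣i∣+∣j∣ (re (z *ᵍ z)) (re (sumSq zs)))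
               (ℕₚ.+-mono-≤ (∣re[z²]∣≤ {z} bz) (∣re-sumSq∣≤ bzs))

  ∣im-sumSq∣≤ : ∀ {zs} → All (Bounded c) zs → ∣ im (sumSq zs) ∣ ≤ length zs * (2 * (c * c))
  ∣im-sumSq∣≤ []                  = z≤n
  ∣im-sumSq∣≤ {z ∷ zs} (bz ∷ bzs) =
    ℕₚ.≤-trans (ℤₚ.∣i+j∣≤∣i∣+∣j∣ (im (z *ᵍ z)) (im (sumSq zs)))
               (ℕₚ.+-mono-≤ (∣im[z²]∣≤ {z} bz) (∣im-sumSq∣≤ bzs))

-- 5 = 1² + 2², from the bounds L c² and 2 L c² on the real and imaginary parts of a sum of L squares.
normBound : ℕ → ℕ → ℕ
normBound c L = 5 * ((L * (c * c)) * (L * (c * c)))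

normSq-sumSq≤ : ∀ {c zs} → All (Bounded c) zs → normSq (sumSq zs) ℤ.≤ + normBound c (length zs)
normSq-sumSq≤ {c} {zs} bzs = begin
  normSq (sumSq zs)                                  ≡⟨ normSq≡ (sumSq zs) ⟩
  + (X * X + Y * Y)                                  ≤⟨ ℤ.+≤+ (ℕₚ.+-mono-≤ (ℕₚ.*-mono-≤ X≤ X≤) (ℕₚ.*-mono-≤ Y≤ Y≤)) ⟩
  + ((L * K) * (L * K) + (L * (2 * K)) * (L * (2 * K))) ≡⟨ cong +_ (sum-of-squares L K) ⟩
  + normBound c L                                    ∎
  where
  open ℤₚ.≤-Reasoning
  L = length zs
  K = c * c
  X = ∣ re (sumSq zs) ∣
  Y = ∣ im (sumSq zs) ∣
  X≤ : X ≤ L * K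
  X≤ = ∣re-sumSq∣≤ bzs
  Y≤ : Y ≤ L * (2 * K)
  Y≤ = ∣im-sumSq∣≤ bzs
  sum-of-squares : ∀ l k → (l * k) * (l * k) + (l * (2 * k)) * (l * (2 * k)) ≡ 5 * ((l * k) * (l * k))
  sum-of-squares = solve 2 (λ l k → (l :* k) :* (l :* k) :+ (l :* (con 2 :* k)) :* (l :* (con 2 :* k))
                                    := con 5 :* ((l :* k) :* (l :* k))) refl

normBound-mono : ∀ c {L L′} → L ≤ L′ → normBound c L ≤ normBound c L′
normBound-mono c {L} {L′} L≤L′ = ℕₚ.*-monoʳ-≤ 5 (ℕₚ.*-mono-≤ LK≤L′K LK≤L′K)
  where
  LK≤L′K : L * (c * c) ≤ L′ * (c * c)
  LK≤L′K = ℕₚ.*-monoˡ-≤ (c * c) L≤L′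

normBound-suc≤ : ∀ c {L} → 1 ≤ L → normBound c (suc L) ≤ 4 * normBound c L
normBound-suc≤ c {L} 1≤L = begin
  5 * (suc L * K * (suc L * K))              ≤⟨ ℕₚ.*-monoʳ-≤ 5 (ℕₚ.*-mono-≤ [1+L]K≤2LK [1+L]K≤2LK) ⟩
  5 * ((L * K + L * K) * (L * K + L * K))    ≡⟨ double-squared (L * K) ⟩
  4 * normBound c L                          ∎
  where
  open ℕₚ.≤-Reasoning
  K = c * c
  [1+L]K≤2LK : suc L * K ≤ L * K + L * K
  [1+L]K≤2LK = ℕₚ.+-monoˡ-≤ (L * K) (ℕₚ.m≤n*m K L {{ℕ.>-nonZero 1≤L}})
  double-squared : ∀ w → 5 * ((w + w) * (w + w)) ≡ 4 * (5 * (w * w))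
  double-squared = solve 1 (λ w → con 5 :* ((w :+ w) :* (w :+ w)) := con 4 :* (con 5 :* (w :* w))) refl

square-* : ∀ b p → (p * p) * (b * b) ≡ (b * p) * (b * p)
square-* = solve 2 (λ b p → (p :* p) :* (b :* b) := (b :* p) :* (b :* p)) refl

module _ {c : ℕ} (1≤c : 1 ≤ c) where

  private
    B : ℕ
    B = suc c

  normBound*B²<B^2L : ∀ k → normBound c (suc k) ℕ.< B ^ k * B ^ k →
                      ∀ j → normBound c (j + suc k) * (B * B) ℕ.< B ^ (j + suc k) * B ^ (j + suc k)
  normBound*B²<B^2L k base zero = begin-strict
    normBound c (suc k) * (B * B)   <⟨ ℕₚ.*-monoˡ-< (B * B) base ⟩
    B ^ k * B ^ k * (B * B)         ≡⟨ square-* B (B ^ k) ⟩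
    B ^ suc k * B ^ suc k           ∎
    where open ℕₚ.≤-Reasoning
  normBound*B²<B^2L k base (suc j) = begin-strict
    normBound c (suc n) * (B * B)   ≤⟨ ℕₚ.*-monoˡ-≤ (B * B) (normBound-suc≤ c 1≤n) ⟩
    4 * normBound c n * (B * B)     ≡⟨ ℕₚ.*-assoc 4 (normBound c n) (B * B) ⟩
    4 * (normBound c n * (B * B))   <⟨ ℕₚ.*-monoʳ-< 4 (normBound*B²<B^2L k base j) ⟩
    4 * (P * P)                     ≤⟨ ℕₚ.*-monoˡ-≤ (P * P) (ℕₚ.*-mono-≤ (s≤s 1≤c) (s≤s 1≤c)) ⟩
    B * B * (P * P)                 ≡⟨ ℕₚ.*-comm (B * B) (P * P) ⟩
    P * P * (B * B)                 ≡⟨ square-* B P ⟩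
    B ^ suc n * B ^ suc n           ∎
    where
    open ℕₚ.≤-Reasoning
    n = j + suc k
    P = B ^ n
    1≤n : 1 ≤ n
    1≤n = ℕₚ.≤-trans (s≤s z≤n) (ℕₚ.m≤n+m (suc k) j)

  normBound<square : ∀ k {m L} → normBound c (suc k) ℕ.< B ^ k * B ^ k →
                     B ^ k ≤ m → B ^ L ≤ B * m → normBound c L ℕ.< m * m
  normBound<square k {m} {L} base B^k≤m B^L≤Bm with L ℕ.≤? suc k
  ... | yes L≤1+k = ℕₚ.≤-<-trans (normBound-mono c L≤1+k) (<-≤-trans base (ℕₚ.*-mono-≤ B^k≤m B^k≤m))
  ... | no  L≰1+k = ℕₚ.*-cancelʳ-< (B * B) (normBound c L) (m * m) (begin-strict
    normBound c L * (B * B)   <⟨ subst (λ t → normBound c t * (B * B) ℕ.< B ^ t * B ^ t) j+1+k≡L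
                                       (normBound*B²<B^2L k base (L ∸ suc k)) ⟩
    B ^ L * B ^ L             ≤⟨ ℕₚ.*-mono-≤ B^L≤Bm B^L≤Bm ⟩
    B * m * (B * m)           ≡⟨ square-* B m ⟨
    m * m * (B * B)           ∎)
    where
    open ℕₚ.≤-Reasoning
    j+1+k≡L : L ∸ suc k + suc k ≡ L
    j+1+k≡L = ℕₚ.m∸n+n≡m (ℕₚ.<⇒≤ (ℕₚ.≰⇒> L≰1+k))

-- (1 + c)³ exceeds (3 + c) c², and (3 + c)² ≥ 81 > 80 once c ≥ 6.
normBound-4< : ∀ c → 6 ≤ c → normBound c 4 ℕ.< suc c ^ 3 * suc c ^ 3
normBound-4< c 6≤c = begin-strict
  normBound c 4                        ≡⟨ normBound-4≡ c ⟩
  80 * (u * u)                         ≤⟨ ℕₚ.*-monoˡ-≤ (u * u) 80≤[3+c]² ⟩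
  (3 + c) * (3 + c) * (u * u)          ≡⟨ square-* u (3 + c) ⟩
  u * (3 + c) * (u * (3 + c))          <⟨ ℕₚ.*-mono-< u[3+c]<[1+c]³ u[3+c]<[1+c]³ ⟩
  suc c ^ 3 * suc c ^ 3                ∎
  where
  open ℕₚ.≤-Reasoning
  u = c * c
  normBound-4≡ : ∀ n → normBound n 4 ≡ 80 * ((n * n) * (n * n))
  normBound-4≡ = solve 1 (λ n → con 5 :* ((con 4 :* (n :* n)) :* (con 4 :* (n :* n)))
                                := con 80 :* ((n :* n) :* (n :* n))) refl
  9≤3+c : 9 ≤ 3 + c
  9≤3+c = ℕₚ.+-monoʳ-≤ 3 6≤c
  80≤[3+c]² : 80 ≤ (3 + c) * (3 + c)
  80≤[3+c]² = ℕₚ.≤-trans (ℕₚ.n≤1+n 80) (ℕₚ.*-mono-≤ 9≤3+c 9≤3+c)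
  cube-expansion : ∀ n → (n * n) * (3 + n) + suc (3 * n) ≡ suc n ^ 3
  cube-expansion = solve 1 (λ n → (n :* n) :* (con 3 :+ n) :+ (con 1 :+ con 3 :* n)
                                  := (con 1 :+ n) :^ 3) refl
  u[3+c]<[1+c]³ : u * (3 + c) ℕ.< suc c ^ 3
  u[3+c]<[1+c]³ = subst (u * (3 + c) ℕ.<_) (cube-expansion c) (ℕₚ.m<m+n (u * (3 + c)) (s≤s z≤n))

normBound-5< : ∀ c → 1 ≤ c → c ≤ 5 → normBound c 5 ℕ.< suc c ^ 4 * suc c ^ 4
normBound-5< 1 _ _ = ℕₚ.≤ᵇ⇒≤ _ _ _
normBound-5< 2 _ _ = ℕₚ.≤ᵇ⇒≤ _ _ _
normBound-5< 3 _ _ = ℕₚ.≤ᵇ⇒≤ _ _ _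
normBound-5< 4 _ _ = ℕₚ.≤ᵇ⇒≤ _ _ _
normBound-5< 5 _ _ = ℕₚ.≤ᵇ⇒≤ _ _ _
normBound-5< (suc (suc (suc (suc (suc (suc _)))))) _ (s≤s (s≤s (s≤s (s≤s (s≤s ())))))

max²≤normSq : ∀ a b → + ((∣ a ∣ ⊔ ∣ b ∣) * (∣ a ∣ ⊔ ∣ b ∣)) ℤ.≤ normSq (a , b)
max²≤normSq a b = subst (+ ((∣ a ∣ ⊔ ∣ b ∣) * (∣ a ∣ ⊔ ∣ b ∣)) ℤ.≤_) (sym (normSq≡ (a , b))) (ℤ.+≤+ (begin
  (∣ a ∣ ⊔ ∣ b ∣) * (∣ a ∣ ⊔ ∣ b ∣)  ≡⟨ ℕₚ.mono-≤-distrib-⊔ (λ x≤y → ℕₚ.*-mono-≤ x≤y x≤y) ∣ a ∣ ∣ b ∣ ⟩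
  a² ⊔ b²                            ≤⟨ ℕₚ.⊔-lub (ℕₚ.m≤m+n a² b²) (ℕₚ.m≤n+m b² a²) ⟩
  a² + b²                            ∎))
  where
  open ℕₚ.≤-Reasoning
  a² = ∣ a ∣ * ∣ a ∣
  b² = ∣ b ∣ * ∣ b ∣

module _ (c : ℕ) where

  private
    B : ℕ
    B = suc c

  normSq-S≤ : ∀ g → normSq (S B g) ℤ.≤ + normBound c (length (gdigits B g))
  normSq-S≤ (a , b) = normSq-sumSq≤ (All-zipPad (λ x → ∣ x ∣ ≤ c) z≤n (digits≤c a) (digits≤c b))
    where
    digits≤c : ∀ x → All (λ z → ∣ z ∣ ≤ c) (signedDigits B x)
    digits≤c x = All.map s≤s⁻¹ (All-∣∣<-signedDigits B x)

  ^length-gdigits≤ : ∀ a b → 1 ≤ ∣ a ∣ ⊔ ∣ b ∣ → B ^ length (gdigits B (a , b)) ≤ B * (∣ a ∣ ⊔ ∣ b ∣)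
  ^length-gdigits≤ a b 1≤m = begin
    B ^ length (zipPad (signedDigits B a) (signedDigits B b))
      ≡⟨ cong (B ^_) (length-zipPad (signedDigits B a) (signedDigits B b)) ⟩
    B ^ (length (signedDigits B a) ⊔ length (signedDigits B b))
      ≡⟨ cong₂ (λ la lb → B ^ (la ⊔ lb)) (length-signedDigits B a) (length-signedDigits B b) ⟩
    B ^ (length (digits B ∣ a ∣) ⊔ length (digits B ∣ b ∣))
      ≡⟨ ℕₚ.mono-≤-distrib-⊔ (ℕₚ.^-monoʳ-≤ B) (length (digits B ∣ a ∣)) (length (digits B ∣ b ∣)) ⟩
    B ^ length (digits B ∣ a ∣) ⊔ B ^ length (digits B ∣ b ∣)
      ≤⟨ ℕₚ.⊔-lub (^length-digits≤ B 1≤m (ℕₚ.m≤m⊔n ∣ a ∣ ∣ b ∣))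
                  (^length-digits≤ B 1≤m (ℕₚ.m≤n⊔m ∣ a ∣ ∣ b ∣)) ⟩
    B * (∣ a ∣ ⊔ ∣ b ∣) ∎
    where open ℕₚ.≤-Reasoning

  normSq-S< : 1 ≤ c → ∀ k a b → normBound c (suc k) ℕ.< B ^ k * B ^ k → B ^ k ≤ ∣ a ∣ ⊔ ∣ b ∣ →
              normSq (S B (a , b)) < normSq (a , b)
  normSq-S< 1≤c k a b base B^k≤m = begin-strict
    normSq (S B (a , b))  ≤⟨ normSq-S≤ (a , b) ⟩
    + normBound c L       <⟨ ℤ.+<+ (normBound<square 1≤c k {L = L} base B^k≤m (^length-gdigits≤ a b 1≤m)) ⟩
    + (m * m)             ≤⟨ max²≤normSq a b ⟩
    normSq (a , b)        ∎
    where
    open ℤₚ.≤-Reasoning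
    L = length (gdigits B (a , b))
    m = ∣ a ∣ ⊔ ∣ b ∣
    1≤m : 1 ≤ m
    1≤m = ℕₚ.≤-trans (ℕₚ.m^n>0 B k) B^k≤m

theorem4 : (B : ℕ) → (2≤B : 2 ≤ B) → (g : ℤ[i])
    → (7 ≤ B → B ^ 3 ≤ ∣ re g ∣ ⊔ ∣ im g ∣)
    → (B ≤ 6 → B ^ 4 ≤ ∣ re g ∣ ⊔ ∣ im g ∣)
    → normSq (S B {{ℕ.>-nonZero (ℕₚ.<-≤-trans (ℕ.s≤s ℕ.z≤n) 2≤B)}} g) < normSq g
theorem4 (suc c) (s≤s 1≤c) (a , b) large small with suc c ℕ.≤? 6
... | yes B≤6 = normSq-S< c 1≤c 4 a b (normBound-5< c 1≤c (s≤s⁻¹ B≤6)) (small B≤6)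
... | no  B≰6 = normSq-S< c 1≤c 3 a b (normBound-4< c (s≤s⁻¹ 7≤B)) (large 7≤B)
  where
  7≤B : 7 ≤ suc c
  7≤B = ℕₚ.≰⇒> B≰6
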